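{- Let $\mathcal{Q}$ be a finite connected acyclic quiver with vertex set $\{1,\dots,n\}$. For each $i\in\{1,\dots,n\}$ let $d^i:\mathbb{Z}\mathcal{Q}_0\to\mathbb{Z}$ be the additive frieze with initial values $d^i(0,j)=$ the number of paths in $\mathcal{Q}$ from $i$ to $j$ (including the trivial path when $j=i$), $j=1,\dots,n$. For $m\in\mathbb{Z}$ write $d^i_m=(d^i(m,1),\dots,d^i(m,n))^t\in\mathbb{Z}^n$. Then for every $i$ and every $m\in\mathbb{Z}$, $$d^i_m=\Phi_{\mathcal{Q}}^{ -1}\,d^i_{m-1}.$$
   Context: The repetition quiver $\mathbb{Z}\mathcal{Q}$ has vertices $(m,i)$, $m\in\mathbb{Z}$, $i\in\mathcal{Q}_0$, and for each arrow $i\to j$ of $\mathcal{Q}$ the arrows $(m,i)\to(m,j)$ and $(m,j)\to(m+1,i)$; these are all its arrows; $\tau(m,i)=(m-1,i)$. An additive frieze is a function $f$ on the vertices of $\mathbb{Z}\mathcal{Q}$ with $f(\tau v)+f(v)=\sum_{w\to v}f(w)$ for all $v$ (sum over arrows of $\mathbb{Z}\mathcal{Q}$ ending at $v$, with multiplicity); it is determined by its values on $\{(0,j)\}$. The Cartan matrix is $C_{\mathcal{Q}}=(c_{ij})$ with $c_{ij}$ the number of paths in $\mathcal{Q}$ from $j$ to $i$ (so $c_{ii}=1$); it is invertible. The Coxeter transformation is $\Phi_{\mathcal{Q}}=-\,C_{\mathcal{Q}}^{t}\,C_{\mathcal{Q}}^{ -1}$, where $t$ denotes transpose. -}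

module Defs where

open import Data.Nat using (ℕ; zero; suc; _<_)
open import Data.Fin using (Fin; zero; suc; _≟_)
open import Data.Integer using (ℤ; +_; _+_; _*_; -_; _-_; 0ℤ; 1ℤ)
open import Relation.Binary.PropositionalEquality using (_≡_)
open import Relation.Nullary using (¬_; yes; no)
open import Function.Bundles using (_↔_)

Σ : ∀ {k} → (Fin k → ℤ) → ℤ
Σ {zero} f = 0ℤ
Σ {suc k} f = f zero + Σ (λ x → f (suc x))

-- A finite quiver with vertex set Fin n (vertex i ∈ Fin n stands for i+1)
-- and arrow set Fin m, with source and target maps.
record Quiver (n : ℕ) : Set where
  field
    m   : ℕ
    src : Fin m → Fin n
    tgt : Fin m → Fin n
open Quiver public

data Path {n} (Q : Quiver n) : Fin n → Fin n → Set where
  triv : (i : Fin n) → Path Q i i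
  _∷_  : ∀ {j} (a : Fin (m Q)) → Path Q (tgt Q a) j → Path Q (src Q a) j

len : ∀ {n} {Q : Quiver n} {i j} → Path Q i j → ℕ
len (triv _) = 0
len (a ∷ p) = suc (len p)

Acyclic : ∀ {n} → Quiver n → Set
Acyclic {n} Q = ∀ (i : Fin n) (p : Path Q i i) → ¬ (0 < len p)

data Linked {n} (Q : Quiver n) : Fin n → Fin n → Set where
  here : ∀ i → Linked Q i i
  fwd  : ∀ {j} (a : Fin (m Q)) → Linked Q (tgt Q a) j → Linked Q (src Q a) j
  bwd  : ∀ {j} (a : Fin (m Q)) → Linked Q (src Q a) j → Linked Q (tgt Q a) j

Connected : ∀ {n} → Quiver n → Set
Connected {n} Q = ∀ (i j : Fin n) → Linked Q i j

[_≡ᵛ_] : ∀ {n} → Fin n → Fin n → ℤ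
[ i ≡ᵛ j ] with i ≟ j
... | yes _ = 1ℤ
... | no _  = 0ℤ

-- Additive frieze on ZQ: f m i = f(m,i).  Arrows of ZQ ending at (m,v):
-- (m,src a) → (m,v) for each arrow a with tgt a = v, and
-- (m-1,tgt a) → (m,v) for each arrow a with src a = v.
-- Mesh relation: f(τ v) + f(v) = Σ_{w → v} f(w).
IsAdditiveFrieze : ∀ {n} → Quiver n → (ℤ → Fin n → ℤ) → Set
IsAdditiveFrieze {n} Q f =
  ∀ (k : ℤ) (v : Fin n) →
    f (k - 1ℤ) v + f k v
      ≡ Σ (λ a → [ tgt Q a ≡ᵛ v ] * f k (src Q a))
        + Σ (λ a → [ src Q a ≡ᵛ v ] * f (k - 1ℤ) (tgt Q a))

Matrix : ℕ → Set
Matrix n = Fin n → Fin n → ℤ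

Vector : ℕ → Set
Vector n = Fin n → ℤ

_⊗_ : ∀ {n} → Matrix n → Matrix n → Matrix n
(A ⊗ B) i j = Σ (λ k → A i k * B k j)

_·_ : ∀ {n} → Matrix n → Vector n → Vector n
(A · x) i = Σ (λ k → A i k * x k)

_ᵗ : ∀ {n} → Matrix n → Matrix n
(A ᵗ) i j = A j i

neg : ∀ {n} → Matrix n → Matrix n
neg A i j = - A i j

Id : ∀ {n} → Matrix n
Id i j = [ i ≡ᵛ j ]

IsInverse : ∀ {n} → Matrix n → Matrix n → Set
IsInverse {n} A B = (∀ i j → (A ⊗ B) i j ≡ Id i j) × (∀ i j → (B ⊗ A) i j ≡ Id i j)
  where open import Data.Product using (_×_)

IsCartanMatrix : ∀ {n} → Quiver n → (Fin n → Fin n → ℕ) → Set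
IsCartanMatrix {n} Q c = ∀ (i j : Fin n) → Path Q j i ↔ Fin (c i j)

ℤ-mat : ∀ {n} → (Fin n → Fin n → ℕ) → Matrix n
ℤ-mat c i j = + c i j

Coxeter : ∀ {n} → Matrix n → Matrix n → Matrix n
Coxeter C Cinv = neg ((C ᵗ) ⊗ Cinv)

-- Write Tx v = Σ_{a : u → v} x u and Tᵗy v = Σ_{a : v → w} y w. Splitting a path by its first
-- arrow gives C = I + C T, so C⁻¹ = I − T; the mesh relation says exactly (I − T) d_m =
-- −(I − Tᵗ) d_{m−1}. Hence Φ d_m = −Cᵗ C⁻¹ d_m = Cᵗ (I − Tᵗ) d_{m−1} = ((I − T) C)ᵗ d_{m−1} = d_{m−1}.
-- Only the mesh relation and the Cartan matrix enter: connectedness, acyclicity (already implied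
-- by C having finite entries) and the initial values of dⁱ play no role.
module Submission where

open import Defs
open import Data.Nat.Base as ℕ using (ℕ; zero; suc)
import Data.Nat.Properties as ℕ
open import Data.Integer.Base using (ℤ; +_; _+_; _*_; -_; _-_; 0ℤ; 1ℤ)
import Data.Integer.Properties as ℤ
open import Data.Integer.Tactic.RingSolver using (solve)
open import Data.Fin.Base using (Fin; zero; suc; punchIn)
open import Data.Fin using (_≟_)
open import Data.Fin.Properties using (punchInᵢ≢i; +↔⊎; *↔×)
open import Data.Fin.Permutation using (↔⇒≡)
open import Data.Bool.Base using (if_then_else_)
open import Data.List.Base using ([]; _∷_)
open import Data.Product.Base using (Σ-syntax; _×_; _,_; proj₂)
open import Data.Product.Function.NonDependent.Propositional using (_×-↔_)
open import Data.Sum.Base using (_⊎_; inj₁; inj₂)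
open import Data.Sum.Function.Propositional using (_⊎-↔_)
open import Function.Base using (_∘_)
open import Function.Bundles using (_↔_; mk↔ₛ′)
open import Function.Properties.Inverse using (↔-sym; ↔-trans)
open import Function.Related.Propositional using (module EquationalReasoning)
open import Relation.Binary.PropositionalEquality
  using (_≡_; _≢_; _≗_; refl; sym; trans; cong; cong₂; module ≡-Reasoning)
open import Relation.Nullary using (Dec; yes; no; does; Irrelevant; contradiction)
open import Axiom.UniquenessOfIdentityProofs using (module Decidable⇒UIP)
open import Algebra.Properties.Semiring.Sum ℤ.+-*-semiring
  using (sum; sum-cong-≗; ∑-comm; ∑-distrib-+; *-distribˡ-sum; *-distribʳ-sum; sum-remove; sum-replicate-zero)
open import Algebra.Properties.Monoid.Sum ℕ.+-0-monoid using () renaming (sum to sumℕ)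

Σ≡sum : ∀ {k} (f : Fin k → ℤ) → Σ f ≡ sum f
Σ≡sum {zero}  f = refl
Σ≡sum {suc k} f = cong (_+_ (f zero)) (Σ≡sum (f ∘ suc))

Σ-cong : ∀ {k} {f g : Fin k → ℤ} → f ≗ g → Σ f ≡ Σ g
Σ-cong {f = f} {g} f≗g = trans (Σ≡sum f) (trans (sum-cong-≗ f≗g) (sym (Σ≡sum g)))

+-sumℕ : ∀ {k} (g : Fin k → ℕ) → + sumℕ g ≡ sum (λ a → + g a)
+-sumℕ {zero}  g = refl
+-sumℕ {suc k} g = trans (ℤ.pos-+ (g zero) (sumℕ (g ∘ suc))) (cong (_+_ (+ g zero)) (+-sumℕ (g ∘ suc)))

sum-neg : ∀ {k} (f : Fin k → ℤ) → sum (λ a → - f a) ≡ - sum f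
sum-neg {zero}  f = refl
sum-neg {suc k} f =
  trans (cong (_+_ (- f zero)) (sum-neg (f ∘ suc))) (sym (ℤ.neg-distrib-+ (f zero) (sum (f ∘ suc))))

[≡ᵛ]-refl : ∀ {n} (i : Fin n) → [ i ≡ᵛ i ] ≡ 1ℤ
[≡ᵛ]-refl i with i ≟ i
... | yes _   = refl
... | no i≢i = contradiction refl i≢i

[≡ᵛ]-≢ : ∀ {n} {i j : Fin n} → i ≢ j → [ i ≡ᵛ j ] ≡ 0ℤ
[≡ᵛ]-≢ {i = i} {j} i≢j with i ≟ j
... | yes i≡j = contradiction i≡j i≢j
... | no _    = refl

sum-δ : ∀ {k} (i : Fin k) (f : Fin k → ℤ) → sum (λ j → [ i ≡ᵛ j ] * f j) ≡ f i
sum-δ {suc k} i f = begin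
  sum (λ j → [ i ≡ᵛ j ] * f j)
    ≡⟨ sum-remove {i = i} (λ j → [ i ≡ᵛ j ] * f j) ⟩
  [ i ≡ᵛ i ] * f i + sum (λ j → [ i ≡ᵛ punchIn i j ] * f (punchIn i j))
    ≡⟨ cong₂ _+_ (cong (_* f i) ([≡ᵛ]-refl i)) (sum-cong-≗ off-diagonal) ⟩
  1ℤ * f i + sum {k} (λ _ → 0ℤ)
    ≡⟨ cong₂ _+_ (ℤ.*-identityˡ (f i)) (sum-replicate-zero k) ⟩
  f i + 0ℤ
    ≡⟨ ℤ.+-identityʳ (f i) ⟩
  f i ∎
  where
  open ≡-Reasoning
  off-diagonal : ∀ j → [ i ≡ᵛ punchIn i j ] * f (punchIn i j) ≡ 0ℤ
  off-diagonal j = trans (cong (_* f (punchIn i j)) ([≡ᵛ]-≢ (punchInᵢ≢i i j ∘ sym))) (ℤ.*-zeroˡ (f (punchIn i j)))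

∑-fibres : ∀ {k l} (g : Fin l → Fin k) (f : Fin k → ℤ) (h : Fin l → ℤ) →
  sum (λ v → f v * sum (λ a → [ g a ≡ᵛ v ] * h a)) ≡ sum (λ a → f (g a) * h a)
∑-fibres g f h = begin
  sum (λ v → f v * sum (λ a → [ g a ≡ᵛ v ] * h a))
    ≡⟨ sum-cong-≗ (λ v → *-distribˡ-sum (f v) (λ a → [ g a ≡ᵛ v ] * h a)) ⟩
  sum (λ v → sum (λ a → f v * ([ g a ≡ᵛ v ] * h a)))
    ≡⟨ sum-cong-≗ (λ v → sum-cong-≗ (λ a → swap-factors (f v) [ g a ≡ᵛ v ] (h a))) ⟩
  sum (λ v → sum (λ a → [ g a ≡ᵛ v ] * (f v * h a)))
    ≡⟨ ∑-comm (λ v a → [ g a ≡ᵛ v ] * (f v * h a)) ⟩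
  sum (λ a → sum (λ v → [ g a ≡ᵛ v ] * (f v * h a)))
    ≡⟨ sum-cong-≗ (λ a → sum-δ (g a) (λ v → f v * h a)) ⟩
  sum (λ a → f (g a) * h a) ∎
  where
  open ≡-Reasoning
  swap-factors : ∀ x y z → x * (y * z) ≡ y * (x * z)
  swap-factors x y z = solve (x ∷ y ∷ z ∷ [])

infixl 6 _-ᵥ_

_-ᵥ_ : ∀ {n} → Vector n → Vector n → Vector n
(x -ᵥ y) k = x k - y k

⟨_,_⟩ : ∀ {n} → Vector n → Vector n → ℤ
⟨ x , y ⟩ = sum (λ k → x k * y k)

⟨⟩-comm : ∀ {n} (x y : Vector n) → ⟨ x , y ⟩ ≡ ⟨ y , x ⟩
⟨⟩-comm x y = sum-cong-≗ (λ k → ℤ.*-comm (x k) (y k))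

⟨⟩-congˡ : ∀ {n} {x y : Vector n} → x ≗ y → ∀ z → ⟨ x , z ⟩ ≡ ⟨ y , z ⟩
⟨⟩-congˡ x≗y z = sum-cong-≗ (λ k → cong (_* z k) (x≗y k))

⟨⟩-congʳ : ∀ {n} (x : Vector n) {y z : Vector n} → y ≗ z → ⟨ x , y ⟩ ≡ ⟨ x , z ⟩
⟨⟩-congʳ x y≗z = sum-cong-≗ (λ k → cong (x k *_) (y≗z k))

⟨⟩-distribʳ--ᵥ : ∀ {n} (x y z : Vector n) → ⟨ x , y -ᵥ z ⟩ ≡ ⟨ x , y ⟩ - ⟨ x , z ⟩
⟨⟩-distribʳ--ᵥ x y z = begin
  sum (λ k → x k * (y k - z k))
    ≡⟨ sum-cong-≗ (λ k → expand (x k) (y k) (z k)) ⟩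
  sum (λ k → x k * y k + - (x k * z k))
    ≡⟨ ∑-distrib-+ (λ k → x k * y k) (λ k → - (x k * z k)) ⟩
  ⟨ x , y ⟩ + sum (λ k → - (x k * z k))
    ≡⟨ cong (_+_ ⟨ x , y ⟩) (sum-neg (λ k → x k * z k)) ⟩
  ⟨ x , y ⟩ - ⟨ x , z ⟩ ∎
  where
  open ≡-Reasoning
  expand : ∀ a b c → a * (b - c) ≡ a * b + - (a * c)
  expand a b c = solve (a ∷ b ∷ c ∷ [])

⟨⟩-distribˡ--ᵥ : ∀ {n} (x y z : Vector n) → ⟨ x -ᵥ y , z ⟩ ≡ ⟨ x , z ⟩ - ⟨ y , z ⟩
⟨⟩-distribˡ--ᵥ x y z = begin
  ⟨ x -ᵥ y , z ⟩            ≡⟨ ⟨⟩-comm (x -ᵥ y) z ⟩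
  ⟨ z , x -ᵥ y ⟩            ≡⟨ ⟨⟩-distribʳ--ᵥ z x y ⟩
  ⟨ z , x ⟩ - ⟨ z , y ⟩     ≡⟨ cong₂ _-_ (⟨⟩-comm z x) (⟨⟩-comm z y) ⟩
  ⟨ x , z ⟩ - ⟨ y , z ⟩ ∎
  where open ≡-Reasoning

·≡⟨⟩ : ∀ {n} (A : Matrix n) (x : Vector n) i → (A · x) i ≡ ⟨ A i , x ⟩
·≡⟨⟩ A x i = Σ≡sum (λ k → A i k * x k)

·-congˡ : ∀ {n} {A B : Matrix n} → (∀ i j → A i j ≡ B i j) → ∀ x → A · x ≗ B · x
·-congˡ A≡B x i = Σ-cong (λ k → cong (_* x k) (A≡B i k))

·-congʳ : ∀ {n} (A : Matrix n) {x y : Vector n} → x ≗ y → A · x ≗ A · y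
·-congʳ A x≗y i = Σ-cong (λ k → cong (A i k *_) (x≗y k))

Id-· : ∀ {n} (x : Vector n) → Id · x ≗ x
Id-· x i = trans (·≡⟨⟩ Id x i) (sum-δ i x)

neg-· : ∀ {n} (A : Matrix n) (x : Vector n) i → (neg A · x) i ≡ - (A · x) i
neg-· A x i = begin
  (neg A · x) i                ≡⟨ ·≡⟨⟩ (neg A) x i ⟩
  sum (λ k → - A i k * x k)    ≡⟨ sum-cong-≗ (λ k → ℤ.neg-distribˡ-* (A i k) (x k)) ⟨
  sum (λ k → - (A i k * x k))  ≡⟨ sum-neg (λ k → A i k * x k) ⟩
  - ⟨ A i , x ⟩                ≡⟨ cong -_ (·≡⟨⟩ A x i) ⟨
  - (A · x) i ∎
  where open ≡-Reasoning

⊗-· : ∀ {n} (A B : Matrix n) (x : Vector n) i → ((A ⊗ B) · x) i ≡ (A · (B · x)) i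
⊗-· A B x i = begin
  ((A ⊗ B) · x) i
    ≡⟨ ·≡⟨⟩ (A ⊗ B) x i ⟩
  sum (λ j → Σ (λ k → A i k * B k j) * x j)
    ≡⟨ sum-cong-≗ (λ j → cong (_* x j) (Σ≡sum (λ k → A i k * B k j))) ⟩
  sum (λ j → sum (λ k → A i k * B k j) * x j)
    ≡⟨ sum-cong-≗ (λ j → *-distribʳ-sum (x j) (λ k → A i k * B k j)) ⟩
  sum (λ j → sum (λ k → A i k * B k j * x j))
    ≡⟨ sum-cong-≗ (λ j → sum-cong-≗ (λ k → ℤ.*-assoc (A i k) (B k j) (x j))) ⟩
  sum (λ j → sum (λ k → A i k * (B k j * x j)))
    ≡⟨ ∑-comm (λ j k → A i k * (B k j * x j)) ⟩
  sum (λ k → sum (λ j → A i k * (B k j * x j)))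
    ≡⟨ sum-cong-≗ (λ k → *-distribˡ-sum (A i k) (λ j → B k j * x j)) ⟨
  ⟨ A i , (λ k → ⟨ B k , x ⟩) ⟩
    ≡⟨ ⟨⟩-congʳ (A i) (·≡⟨⟩ B x) ⟨
  ⟨ A i , B · x ⟩
    ≡⟨ ·≡⟨⟩ A (B · x) i ⟨
  (A · (B · x)) i ∎
  where open ≡-Reasoning

·-inverseˡ : ∀ {n} (A B : Matrix n) → (∀ i j → (A ⊗ B) i j ≡ Id i j) → ∀ x → A · (B · x) ≗ x
·-inverseˡ A B AB≡Id x i = begin
  (A · (B · x)) i  ≡⟨ ⊗-· A B x i ⟨
  ((A ⊗ B) · x) i  ≡⟨ ·-congˡ AB≡Id x i ⟩
  (Id · x) i       ≡⟨ Id-· x i ⟩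
  x i ∎
  where open ≡-Reasoning

module _ {n} (C Cinv : Matrix n) (inv : IsInverse C Cinv)
         (L : Vector n → Vector n) (C·L : ∀ x → C · L x ≗ x) where

  ·-inverseʳ-unique : ∀ x → Cinv · x ≗ L x
  ·-inverseʳ-unique x i = begin
    (Cinv · x) i          ≡⟨ ·-congʳ Cinv (λ k → C·L x k) i ⟨
    (Cinv · (C · L x)) i  ≡⟨ ·-inverseˡ Cinv C (proj₂ inv) (L x) i ⟩
    L x i ∎
    where open ≡-Reasoning

  ·-inverseʳ⇒inverseˡ : ∀ x → L (C · x) ≗ x
  ·-inverseʳ⇒inverseˡ x i =
    trans (sym (·-inverseʳ-unique (C · x) i)) (·-inverseˡ Cinv C (proj₂ inv) x i)

-- The arrows of a quiver as operators on vectors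

module _ {n} (Q : Quiver n) where

  incoming : Vector n → Vector n
  incoming x v = sum (λ a → [ tgt Q a ≡ᵛ v ] * x (src Q a))

  outgoing : Vector n → Vector n
  outgoing y v = sum (λ a → [ src Q a ≡ᵛ v ] * y (tgt Q a))

  incoming-cong : ∀ {x y} → x ≗ y → incoming x ≗ incoming y
  incoming-cong x≗y v = sum-cong-≗ (λ a → cong ([ tgt Q a ≡ᵛ v ] *_) (x≗y (src Q a)))

  incoming-adjoint : ∀ x y → ⟨ x , incoming y ⟩ ≡ ⟨ outgoing x , y ⟩
  incoming-adjoint x y = begin
    ⟨ x , incoming y ⟩                      ≡⟨ ∑-fibres (tgt Q) x (y ∘ src Q) ⟩
    sum (λ a → x (tgt Q a) * y (src Q a))  ≡⟨ sum-cong-≗ (λ a → ℤ.*-comm (x (tgt Q a)) (y (src Q a))) ⟩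
    sum (λ a → y (src Q a) * x (tgt Q a))  ≡⟨ ∑-fibres (src Q) y (x ∘ tgt Q) ⟨
    ⟨ y , outgoing x ⟩                      ≡⟨ ⟨⟩-comm y (outgoing x) ⟩
    ⟨ outgoing x , y ⟩ ∎
    where open ≡-Reasoning

  outgoing-adjoint : ∀ x y → ⟨ x , outgoing y ⟩ ≡ ⟨ incoming x , y ⟩
  outgoing-adjoint x y = begin
    ⟨ x , outgoing y ⟩  ≡⟨ ⟨⟩-comm x (outgoing y) ⟩
    ⟨ outgoing y , x ⟩  ≡⟨ incoming-adjoint y x ⟨
    ⟨ y , incoming x ⟩  ≡⟨ ⟨⟩-comm y (incoming x) ⟩
    ⟨ incoming x , y ⟩ ∎
    where open ≡-Reasoning

  frieze-mesh : ∀ {f} → IsAdditiveFrieze Q f → ∀ k →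
    f k -ᵥ incoming (f k) ≗ outgoing (f (k - 1ℤ)) -ᵥ f (k - 1ℤ)
  frieze-mesh {f} mesh k v = rearrange (f (k - 1ℤ) v) (f k v) (incoming (f k) v) (outgoing (f (k - 1ℤ)) v) (begin
    f (k - 1ℤ) v + f k v
      ≡⟨ mesh k v ⟩
    Σ (λ a → [ tgt Q a ≡ᵛ v ] * f k (src Q a)) + Σ (λ a → [ src Q a ≡ᵛ v ] * f (k - 1ℤ) (tgt Q a))
      ≡⟨ cong₂ _+_ (Σ≡sum (λ a → [ tgt Q a ≡ᵛ v ] * f k (src Q a)))
                   (Σ≡sum (λ a → [ src Q a ≡ᵛ v ] * f (k - 1ℤ) (tgt Q a))) ⟩
    incoming (f k) v + outgoing (f (k - 1ℤ)) v ∎)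
    where
    open ≡-Reasoning
    rearrange : ∀ a b c d → a + b ≡ c + d → b - c ≡ d - a
    rearrange a b c d a+b≡c+d = begin
      b - c              ≡⟨ solve (a ∷ b ∷ c ∷ []) ⟩
      (a + b) - (a + c)  ≡⟨ cong (_- (a + c)) a+b≡c+d ⟩
      (c + d) - (a + c)  ≡⟨ solve (a ∷ c ∷ d ∷ []) ⟩
      d - a ∎

-- Counting paths

card? : ∀ {P : Set} → Dec P → ℕ
card? p? = if does p? then 1 else 0

Dec-↔ : ∀ {P : Set} → Irrelevant P → (p? : Dec P) → P ↔ Fin (card? p?)
Dec-↔ irr (yes p) = mk↔ₛ′ (λ _ → zero) (λ _ → p) (λ { zero → refl }) (irr p)
Dec-↔ irr (no ¬p) = mk↔ₛ′ (λ p → contradiction p ¬p) (λ ()) (λ ()) (λ p → contradiction p ¬p)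

×-Fin-↔ : ∀ {A B : Set} {a b} → A ↔ Fin a → B ↔ Fin b → (A × B) ↔ Fin (a ℕ.* b)
×-Fin-↔ A↔a B↔b = ↔-trans (A↔a ×-↔ B↔b) (↔-sym *↔×)

⊎-Fin-↔ : ∀ {A B : Set} {a b} → A ↔ Fin a → B ↔ Fin b → (A ⊎ B) ↔ Fin (a ℕ.+ b)
⊎-Fin-↔ A↔a B↔b = ↔-trans (A↔a ⊎-↔ B↔b) (↔-sym +↔⊎)

Σ-Fin-↔ : ∀ {k} {B : Fin k → Set} {g : Fin k → ℕ} →
  (∀ a → B a ↔ Fin (g a)) → (Σ[ a ∈ Fin k ] B a) ↔ Fin (sumℕ g)
Σ-Fin-↔ {zero}  _   = mk↔ₛ′ (λ ()) (λ ()) (λ ()) (λ ())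
Σ-Fin-↔ {suc k} {B} B↔g = ↔-trans Σ-Fin-suc (⊎-Fin-↔ (B↔g zero) (Σ-Fin-↔ (B↔g ∘ suc)))
  where
  Σ-Fin-suc : (Σ[ a ∈ Fin (suc k) ] B a) ↔ (B zero ⊎ Σ[ a ∈ Fin k ] B (suc a))
  Σ-Fin-suc = mk↔ₛ′ (λ { (zero , b) → inj₁ b ; (suc a , b) → inj₂ (a , b) })
                    (λ { (inj₁ b) → zero , b ; (inj₂ (a , b)) → suc a , b })
                    (λ { (inj₁ b) → refl ; (inj₂ (a , b)) → refl })
                    (λ { (zero , b) → refl ; (suc a , b) → refl })

[≡ᵛ]-card? : ∀ {n} (i j : Fin n) → + card? (i ≟ j) ≡ [ i ≡ᵛ j ]
[≡ᵛ]-card? i j with i ≟ j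
... | yes _ = refl
... | no _  = refl

module _ {n} (Q : Quiver n) where

  PathUncons : Fin n → Fin n → Set
  PathUncons j i = i ≡ j ⊎ Σ[ a ∈ Fin (m Q) ] (src Q a ≡ j × Path Q (tgt Q a) i)

  path-uncons : ∀ j i → Path Q j i ↔ PathUncons j i
  path-uncons j i = mk↔ₛ′ uncons cons
    (λ { (inj₁ refl) → refl ; (inj₂ (a , refl , p)) → refl })
    (λ { (triv _) → refl ; (a ∷ p) → refl })
    where
    uncons : ∀ {j i} → Path Q j i → PathUncons j i
    uncons (triv _) = inj₁ refl
    uncons (a ∷ p)  = inj₂ (a , refl , p)
    cons : ∀ {j i} → PathUncons j i → Path Q j i
    cons (inj₁ refl)           = triv _
    cons (inj₂ (a , refl , p)) = a ∷ p

  path-count : ∀ {c} → IsCartanMatrix Q c → ∀ i j →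
    c i j ≡ card? (i ≟ j) ℕ.+ sumℕ (λ a → card? (src Q a ≟ j) ℕ.* c i (tgt Q a))
  path-count {c} cart i j = ↔⇒≡ (begin
    Fin (c i j)
      ↔⟨ cart i j ⟨
    Path Q j i
      ↔⟨ path-uncons j i ⟩
    PathUncons j i
      ↔⟨ ⊎-Fin-↔ (Dec-↔ ≡-irrelevant (i ≟ j))
                 (Σ-Fin-↔ (λ a → ×-Fin-↔ (Dec-↔ ≡-irrelevant (src Q a ≟ j)) (cart i (tgt Q a)))) ⟩
    Fin (card? (i ≟ j) ℕ.+ sumℕ (λ a → card? (src Q a ≟ j) ℕ.* c i (tgt Q a))) ∎)
    where
    open EquationalReasoning
    open Decidable⇒UIP _≟_ using (≡-irrelevant)

  cartan-row : ∀ {c} → IsCartanMatrix Q c → ∀ i → ℤ-mat c i -ᵥ outgoing Q (ℤ-mat c i) ≗ Id i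
  cartan-row {c} cart i j = begin
    + c i j - out
      ≡⟨ cong (λ t → + t - out) (path-count cart i j) ⟩
    + (card? (i ≟ j) ℕ.+ sumℕ arrows) - out
      ≡⟨ cong (_- out) (ℤ.pos-+ (card? (i ≟ j)) (sumℕ arrows)) ⟩
    + card? (i ≟ j) + + sumℕ arrows - out
      ≡⟨ cong₂ (λ s t → s + t - out) ([≡ᵛ]-card? i j) count-out ⟩
    [ i ≡ᵛ j ] + out - out
      ≡⟨ +-minus [ i ≡ᵛ j ] out ⟩
    [ i ≡ᵛ j ] ∎
    where
    open ≡-Reasoning
    out : ℤ
    out = outgoing Q (ℤ-mat c i) j
    arrows : Fin (m Q) → ℕ
    arrows a = card? (src Q a ≟ j) ℕ.* c i (tgt Q a)
    count-out : + sumℕ arrows ≡ out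
    count-out = trans (+-sumℕ arrows) (sum-cong-≗ (λ a →
      trans (ℤ.pos-* (card? (src Q a ≟ j)) (c i (tgt Q a)))
            (cong (_* + c i (tgt Q a)) ([≡ᵛ]-card? (src Q a) j))))
    +-minus : ∀ x y → x + y - y ≡ x
    +-minus x y = solve (x ∷ y ∷ [])

module _ {n} (Q : Quiver n) (c : Fin n → Fin n → ℕ) (cart : IsCartanMatrix Q c) where

  private
    C : Matrix n
    C = ℤ-mat c

  cartan-·-inverseʳ : ∀ x → C · (x -ᵥ incoming Q x) ≗ x
  cartan-·-inverseʳ x i = begin
    (C · (x -ᵥ incoming Q x)) i                ≡⟨ ·≡⟨⟩ C (x -ᵥ incoming Q x) i ⟩
    ⟨ C i , x -ᵥ incoming Q x ⟩                ≡⟨ ⟨⟩-distribʳ--ᵥ (C i) x (incoming Q x) ⟩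
    ⟨ C i , x ⟩ - ⟨ C i , incoming Q x ⟩       ≡⟨ cong (_-_ ⟨ C i , x ⟩) (incoming-adjoint Q (C i) x) ⟩
    ⟨ C i , x ⟩ - ⟨ outgoing Q (C i) , x ⟩     ≡⟨ ⟨⟩-distribˡ--ᵥ (C i) (outgoing Q (C i)) x ⟨
    ⟨ C i -ᵥ outgoing Q (C i) , x ⟩            ≡⟨ ⟨⟩-congˡ (cartan-row Q cart i) x ⟩
    ⟨ Id i , x ⟩                               ≡⟨ sum-δ i x ⟩
    x i ∎
    where open ≡-Reasoning

  module _ (Cinv : Matrix n) (invC : IsInverse C Cinv) where

    cartanInv-· : ∀ x → Cinv · x ≗ x -ᵥ incoming Q x
    cartanInv-· = ·-inverseʳ-unique C Cinv invC (λ x → x -ᵥ incoming Q x) cartan-·-inverseʳ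

    cartan-column : ∀ i → (C ᵗ) i -ᵥ incoming Q ((C ᵗ) i) ≗ Id i
    cartan-column i k = begin
      (C ᵗ) i k - incoming Q ((C ᵗ) i) k
        ≡⟨ cong₂ _-_ (C·Id k) (incoming-cong Q C·Id k) ⟨
      (C · Id i) k - incoming Q (C · Id i) k
        ≡⟨ ·-inverseʳ⇒inverseˡ C Cinv invC (λ x → x -ᵥ incoming Q x) cartan-·-inverseʳ (Id i) k ⟩
      Id i k ∎
      where
      open ≡-Reasoning
      C·Id : C · Id i ≗ (C ᵗ) i
      C·Id k = trans (·≡⟨⟩ C (Id i) k) (trans (⟨⟩-comm (C k) (Id i)) (sum-δ i (C k)))

    cartanᵗ-· : ∀ y i → ((C ᵗ) · (outgoing Q y -ᵥ y)) i ≡ - y i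
    cartanᵗ-· y i = begin
      ((C ᵗ) · (outgoing Q y -ᵥ y)) i              ≡⟨ ·≡⟨⟩ (C ᵗ) (outgoing Q y -ᵥ y) i ⟩
      ⟨ col , outgoing Q y -ᵥ y ⟩                  ≡⟨ ⟨⟩-distribʳ--ᵥ col (outgoing Q y) y ⟩
      ⟨ col , outgoing Q y ⟩ - ⟨ col , y ⟩         ≡⟨ cong (_- ⟨ col , y ⟩) (outgoing-adjoint Q col y) ⟩
      ⟨ incoming Q col , y ⟩ - ⟨ col , y ⟩         ≡⟨ minus-swap ⟨ incoming Q col , y ⟩ ⟨ col , y ⟩ ⟩
      - (⟨ col , y ⟩ - ⟨ incoming Q col , y ⟩)     ≡⟨ cong -_ (⟨⟩-distribˡ--ᵥ col (incoming Q col) y) ⟨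
      - ⟨ col -ᵥ incoming Q col , y ⟩              ≡⟨ cong -_ (⟨⟩-congˡ (cartan-column i) y) ⟩
      - ⟨ Id i , y ⟩                               ≡⟨ cong -_ (sum-δ i y) ⟩
      - y i ∎
      where
      open ≡-Reasoning
      col : Vector n
      col = (C ᵗ) i
      minus-swap : ∀ a b → a - b ≡ - (b - a)
      minus-swap a b = solve (a ∷ b ∷ [])

    coxeter-frieze : ∀ {f} → IsAdditiveFrieze Q f → ∀ k → Coxeter C Cinv · f k ≗ f (k - 1ℤ)
    coxeter-frieze {f} frieze k i = begin
      (Coxeter C Cinv · f k) i                       ≡⟨ neg-· ((C ᵗ) ⊗ Cinv) (f k) i ⟩
      - (((C ᵗ) ⊗ Cinv) · f k) i                     ≡⟨ cong -_ (⊗-· (C ᵗ) Cinv (f k) i) ⟩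
      - ((C ᵗ) · (Cinv · f k)) i                     ≡⟨ cong -_ (·-congʳ (C ᵗ) Cinv·fₖ i) ⟩
      - ((C ᵗ) · (outgoing Q fₖ₋₁ -ᵥ fₖ₋₁)) i        ≡⟨ cong -_ (cartanᵗ-· fₖ₋₁ i) ⟩
      - - fₖ₋₁ i                                     ≡⟨ ℤ.neg-involutive (fₖ₋₁ i) ⟩
      fₖ₋₁ i ∎
      where
      open ≡-Reasoning
      fₖ₋₁ : Vector n
      fₖ₋₁ = f (k - 1ℤ)
      Cinv·fₖ : Cinv · f k ≗ outgoing Q fₖ₋₁ -ᵥ fₖ₋₁
      Cinv·fₖ v = trans (cartanInv-· (f k) v) (frieze-mesh Q {f} frieze k v)

lemma2p18 : (n : ℕ) (Q : Quiver n) → Connected Q → Acyclic Q →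
    (c : Fin n → Fin n → ℕ) → IsCartanMatrix Q c →
    (Cinv : Matrix n) → IsInverse (ℤ-mat c) Cinv →
    (Φinv : Matrix n) → IsInverse (Coxeter (ℤ-mat c) Cinv) Φinv →
    (i : Fin n) (d : ℤ → Fin n → ℤ) → IsAdditiveFrieze Q d →
    (∀ j → d (+ 0) j ≡ + c j i) →
    ∀ (k : ℤ) (j : Fin n) → d k j ≡ (Φinv · d (k - 1ℤ)) j
lemma2p18 n Q _ _ c cart Cinv invC Φinv invΦ _ d frieze _ k j = begin
  d k j                  ≡⟨ ·-inverseˡ Φinv Φ (proj₂ invΦ) (d k) j ⟨
  (Φinv · (Φ · d k)) j   ≡⟨ ·-congʳ Φinv (coxeter-frieze Q c cart Cinv invC {d} frieze k) j ⟩
  (Φinv · d (k - 1ℤ)) j ∎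
  where
  open ≡-Reasoning
  Φ : Matrix n
  Φ = Coxeter (ℤ-mat c) Cinv
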